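{- Let $s,t,d,k,p,q\in\mathbb{N}$, and let $s':=(d(k-1)(p-1)+1)(s-1)+1$ and $t':=(2d(k-1)(s+q-1)+1)(t-1)+1+sd\,(p+(k-1)(p-1))$. Let $\mathcal{P}$ be a $(k,d)^\star$-shortcut system for a graph $G$. If $G^{\mathcal{P}}$ contains a $(p,q)$-model of $K_{s',t'}$, then $G$ contains a $(p+(k-1)(p-1),\ q+(k-1)(s+q-1))$-model of $K_{s,t}$.
   Context: All graphs are finite, simple and undirected. A shortcut system for a graph $G$ is a set $\mathcal{P}$ of paths in $G$ each with at least one edge; a path in $\mathcal{P}$ with endpoints $v,w$ is a $vw$-shortcut. $G^{\mathcal{P}}$ is the simple supergraph of $G$ obtained by adding the edge $vw$ for each $vw$-shortcut in $\mathcal{P}$. $\mathcal{P}$ is a $(k,d)^\star$-shortcut system if every path in $\mathcal{P}$ has length at most $k$, and for every $v\in V(G)$, the set $M_v$ of vertices $u\in V(G)$ for which there exists a $uw$-shortcut in $\mathcal{P}$ having $v$ as an internal vertex satisfies $|M_v|\le d$. For $p,q\in\mathbb{N}$, a $(p,q)$-model of $K_{a,b}$ in a graph $G$ is a family $\{X_1,\dots,X_a;Y_1,\dots,Y_b\}$ of pairwise disjoint connected subgraphs of $G$ such that for each $i\in[a]$, $j\in[b]$ there is an edge of $G$ between $X_i$ and $Y_j$, $|V(X_i)|\le p$ for all $i$, and $|V(Y_j)|\le q$ for all $j$. -}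

module Defs where

open import Data.Nat using (ℕ; zero; suc; _+_; _*_; _∸_; _≤_)
open import Data.Fin using (Fin)
open import Data.Fin.Subset using (Subset; _∈_; ∣_∣)
open import Data.List using (List; []; _∷_; length)
open import Data.List.Relation.Unary.Unique.Propositional using (Unique)
import Data.List.Membership.Propositional as LM
open import Data.Product using (Σ; ∃; _×_; _,_)
open import Data.Sum using (_⊎_)
open import Data.Unit using (⊤)
open import Data.Empty using (⊥)
open import Relation.Binary.PropositionalEquality using (_≡_; _≢_)

record Graph (n : ℕ) : Set₁ where
  field
    E      : Fin n → Fin n → Set
    sym    : ∀ {u v} → E u v → E v u
    irrefl : ∀ {u} → E u u → ⊥

Chain : ∀ {n} → (Fin n → Fin n → Set) → Fin n → List (Fin n) → Set
Chain E x []       = ⊤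
Chain E x (y ∷ ys) = E x y × Chain E y ys

lastOf : ∀ {n} → Fin n → List (Fin n) → Fin n
lastOf x []       = x
lastOf x (y ∷ ys) = lastOf y ys

dropLast : ∀ {A : Set} → List A → List A
dropLast []           = []
dropLast (x ∷ [])     = []
dropLast (x ∷ y ∷ ys) = x ∷ dropLast (y ∷ ys)

record Path {n : ℕ} (G : Graph n) : Set where
  field
    first    : Fin n
    rest     : List (Fin n)
    distinct : Unique (first ∷ rest)
    chain    : Chain (Graph.E G) first rest
    nonTriv  : 1 ≤ length rest

module _ {n : ℕ} {G : Graph n} where
  len : Path G → ℕ
  len P = length (Path.rest P)

  endA endB : Path G → Fin n
  endA P = Path.first P
  endB P = lastOf (Path.first P) (Path.rest P)

  Internal : Fin n → Path G → Set
  Internal v P = v LM.∈ dropLast (Path.rest P)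

ShortcutSystem : ∀ {n} → Graph n → Set
ShortcutSystem G = List (Path G)

M : ∀ {n} {G : Graph n} → ShortcutSystem G → Fin n → Fin n → Set
M 𝒫 v u = Σ _ λ P → (P LM.∈ 𝒫) × ((endA P ≡ u) ⊎ (endB P ≡ u)) × Internal v P

CardLe : ∀ {n} → (Fin n → Set) → ℕ → Set
CardLe {n} S d = ∀ (xs : List (Fin n)) → Unique xs → (∀ {x} → x LM.∈ xs → S x) → length xs ≤ d

IsKDStar : ∀ {n} (G : Graph n) → ℕ → ℕ → ShortcutSystem G → Set
IsKDStar {n} G k d 𝒫 =
  (∀ {P} → P LM.∈ 𝒫 → len P ≤ k) × (∀ (v : Fin n) → CardLe (M 𝒫 v) d)

AugE : ∀ {n} (G : Graph n) → ShortcutSystem G → Fin n → Fin n → Set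
AugE G 𝒫 u v = Graph.E G u v ⊎
  (Σ _ λ P → (P LM.∈ 𝒫) × (((endA P ≡ u) × (endB P ≡ v)) ⊎ ((endA P ≡ v) × (endB P ≡ u))))

data WalkIn {n} (E : Fin n → Fin n → Set) (S : Subset n) : Fin n → Fin n → Set where
  stop : ∀ {u} → u ∈ S → WalkIn E S u u
  step : ∀ {u x w} → u ∈ S → E u x → WalkIn E S x w → WalkIn E S u w

Connected : ∀ {n} → (Fin n → Fin n → Set) → Subset n → Set
Connected E S = (∃ λ v → v ∈ S) × (∀ {u w} → u ∈ S → w ∈ S → WalkIn E S u w)

Disjoint : ∀ {n} → Subset n → Subset n → Set
Disjoint A B = ∀ {v} → v ∈ A → v ∈ B → ⊥

record Model {n : ℕ} (E : Fin n → Fin n → Set) (a b p q : ℕ) : Set where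
  field
    X     : Fin a → Subset n
    Y     : Fin b → Subset n
    connX : ∀ i → Connected E (X i)
    connY : ∀ j → Connected E (Y j)
    sizeX : ∀ i → ∣ X i ∣ ≤ p
    sizeY : ∀ j → ∣ Y j ∣ ≤ q
    disjXX : ∀ i i' → i ≢ i' → Disjoint (X i) (X i')
    disjYY : ∀ j j' → j ≢ j' → Disjoint (Y j) (Y j')
    disjXY : ∀ i j → Disjoint (X i) (Y j)
    edge  : ∀ i j → ∃ λ x → ∃ λ y → x ∈ X i × y ∈ Y j × E x y

s′ : ℕ → ℕ → ℕ → ℕ → ℕ
s′ s d k p = (d * (k ∸ 1) * (p ∸ 1) + 1) * (s ∸ 1) + 1

t′ : ℕ → ℕ → ℕ → ℕ → ℕ → ℕ → ℕ
t′ s t d k p q = (2 * d * (k ∸ 1) * (s + q ∸ 1) + 1) * (t ∸ 1) + 1 + s * d * (p + (k ∸ 1) * (p ∸ 1))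

-- A branch set S of the model in G^𝒫 has a spanning tree with at most |S| − 1 edges; replacing each
-- shortcut edge by its path adds at most (k − 1)(|S| − 1) interior vertices and gives a set that is
-- connected in G.  A Y-set also receives the interiors of the shortcuts realising its edges to the
-- X-sets that are eventually chosen, which explains the stated sizes.  Enlarged sets overlap only in
-- added interior vertices w, and each enlarged set through w contributes its own ends of shortcuts
-- through w, i.e. elements of M_w, in its own branch set; there are at most d of these.  Hence the
-- overlap relation has small out-degree, and greedily taking a set of small total degree selects s
-- pairwise disjoint X-sets among s′, then t pairwise disjoint Y-sets among t′ avoiding the at most
-- s·d·(p + (k − 1)(p − 1)) Y-sets that meet a chosen X-set.  Adjacency survives: walking along the
-- realising shortcut from its X-end, the first step out of the enlarged X-set enters the Y-set.

module Submission where

open import Defs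

open import Data.Bool using (true; false)
open import Data.Empty using (⊥; ⊥-elim)
open import Data.Fin using (Fin; zero; suc; _≟_)
import Data.Fin.Properties as Fin
open import Data.Fin.Subset using (Subset; ⁅_⁆; _∪_; ∣_∣; inside; outside)
  renaming (_∈_ to _∈ₛ_; _∉_ to _∉ₛ_; _⊆_ to _⊆ₛ_; ⊥ to ⊥ₛ)
open import Data.Fin.Subset.Properties
  using (_∈?_; x∈p∪q⁺; x∈p∪q⁻; q⊆p∪q; p⊆q⇒∣p∣≤∣q∣; p⊂q⇒∣p∣<∣q∣; x∈⁅x⁆; x∈⁅y⁆⇒x≡y; ∉⊥; ∣⊥∣≡0; ∣⁅x⁆∣≡1)
open import Data.List using (List; []; _∷_; length; _++_; concatMap; map; filter; allFin)
open import Data.List.Membership.Propositional using (_∈_; _∉_; find)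
open import Data.List.Membership.Propositional.Properties
open import Data.List.Properties using (length-++; length-removeAt′; length-map; length-tabulate; map-cong; map-∘)
open import Data.List.Relation.Binary.Subset.Propositional using (_⊆_)
open import Data.List.Relation.Unary.All as All using (All; []; _∷_)
open import Data.List.Relation.Unary.AllPairs using ([]; _∷_)
open import Data.List.Relation.Unary.Any using (here; there; index; _─_; any?) renaming (map to Any-map)
open import Data.List.Relation.Unary.Unique.Propositional using (Unique)
open import Data.List.Relation.Unary.Unique.Propositional.Properties using (filter⁺; allFin⁺; ++⁺; map⁺)
open import Data.Nat using (ℕ; zero; suc; _+_; _*_; _∸_; _≤_; _<_; z≤n; s≤s; _≤?_; NonZero)
open import Data.Nat.ListAction using (sum)
open import Data.Nat.Properties hiding (_≟_)
open import Algebra.Properties.CommutativeSemigroup *-commutativeSemigroup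
  using () renaming (x∙yz≈y∙xz to x*[y*z]≡y*[x*z])
open import Algebra.Properties.CommutativeSemigroup +-commutativeSemigroup
  using () renaming (interchange to +-interchange; xy∙z≈xz∙y to [x+y]+z≡[x+z]+y)
open import Data.Nat.Tactic.RingSolver using (solve-∀)
open import Data.Product using (Σ; ∃; ∃₂; _×_; _,_; proj₁; proj₂)
import Data.Sum as Sum
open import Data.Sum using (_⊎_; inj₁; inj₂)
open import Data.Sum.Properties using (inj₂-injective)
open import Data.Vec using ([]; _∷_; here; there)
open import Function using (id; _∘_; flip)
open import Level using (0ℓ)
open import Relation.Binary.Construct.Closure.ReflexiveTransitive as Star using (Star; ε; _◅_; _◅◅_)
open import Relation.Binary.PropositionalEquality
  using (_≡_; _≢_; refl; sym; trans; cong; cong₂; subst; ≢-sym; module ≡-Reasoning)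
open import Relation.Nullary using (¬_; Dec; yes; no; does)
open import Relation.Nullary.Decidable using (_⊎-dec_; _×-dec_; ¬?; decidable-stable)
open import Relation.Unary using (Pred; Decidable)
open import Relation.Unary.Properties using (_∪?_; ∁?)

module _ {A : Set} where

  ∈-─⁺ : ∀ {x y : A} {xs} (x∈xs : x ∈ xs) → y ∈ xs → y ≢ x → y ∈ (xs ─ x∈xs)
  ∈-─⁺ (here refl)   (here refl)  y≢x = ⊥-elim (y≢x refl)
  ∈-─⁺ (here refl)   (there y∈xs) _   = y∈xs
  ∈-─⁺ (there _)     (here refl)  _   = here refl
  ∈-─⁺ (there x∈xs)  (there y∈xs) y≢x = there (∈-─⁺ x∈xs y∈xs y≢x)

  Unique⇒length≤ : ∀ {xs ys : List A} → Unique xs → xs ⊆ ys → length xs ≤ length ys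
  Unique⇒length≤ [] _ = z≤n
  Unique⇒length≤ {x ∷ xs} {ys} (x∉xs ∷ xs!) x∷xs⊆ys = begin
      suc (length xs)          ≤⟨ s≤s (Unique⇒length≤ xs! xs⊆ys─x) ⟩
      suc (length (ys ─ x∈ys)) ≡⟨ sym (length-removeAt′ ys (index x∈ys)) ⟩
      length ys                ∎
    where
    open ≤-Reasoning
    x∈ys : x ∈ ys
    x∈ys = x∷xs⊆ys (here refl)
    xs⊆ys─x : xs ⊆ (ys ─ x∈ys)
    xs⊆ys─x y∈xs = ∈-─⁺ x∈ys (x∷xs⊆ys (there y∈xs)) (≢-sym (All.lookup x∉xs y∈xs))

  all-equal⇒length≤1 : ∀ {xs : List A} → Unique xs → (∀ {x y} → x ∈ xs → y ∈ xs → x ≡ y) → length xs ≤ 1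
  all-equal⇒length≤1 {[]}         _                 _    = z≤n
  all-equal⇒length≤1 {_ ∷ []}     _                 _    = s≤s z≤n
  all-equal⇒length≤1 {_ ∷ _ ∷ _} ((x≢y ∷ _) ∷ _) same = ⊥-elim (x≢y (same (here refl) (there (here refl))))

  module _ {P : Pred A 0ℓ} (P? : Decidable P) where

    length-filter-∪ : ∀ {Q : Pred A 0ℓ} (Q? : Decidable Q) xs →
      length (filter (P? ∪? Q?) xs) ≤ length (filter P? xs) + length (filter Q? xs)
    length-filter-∪ Q? [] = z≤n
    length-filter-∪ Q? (x ∷ xs) with ih ← length-filter-∪ Q? xs | does (P? x) | does (Q? x)
    ... | true  | true  = s≤s (≤-trans ih (+-monoʳ-≤ _ (n≤1+n _)))
    ... | true  | false = s≤s ih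
    ... | false | true  = ≤-trans (s≤s ih) (≤-reflexive (sym (+-suc _ _)))
    ... | false | false = ih

    length-filter+filter∁ : ∀ xs → length (filter P? xs) + length (filter (∁? P?) xs) ≡ length xs
    length-filter+filter∁ [] = refl
    length-filter+filter∁ (x ∷ xs) with ih ← length-filter+filter∁ xs | does (P? x)
    ... | true  = cong suc ih
    ... | false = trans (+-suc _ _) (cong suc ih)

  module _ {B : Set} (f : A → List B) where

    length-concatMap-≤ : ∀ {c b} xs → (∀ {x} → x ∈ xs → c * length (f x) ≤ b) →
      c * length (concatMap f xs) ≤ b * length xs
    length-concatMap-≤ {c} {b} [] _ = ≤-reflexive (trans (*-zeroʳ c) (sym (*-zeroʳ b)))
    length-concatMap-≤ {c} {b} (x ∷ xs) bounded = begin
      c * length (f x ++ concatMap f xs)             ≡⟨ cong (c *_) (length-++ (f x)) ⟩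
      c * (length (f x) + length (concatMap f xs))   ≡⟨ *-distribˡ-+ c _ _ ⟩
      c * length (f x) + c * length (concatMap f xs) ≤⟨ +-mono-≤ (bounded (here refl))
                                                                 (length-concatMap-≤ {c} {b} xs (bounded ∘ there)) ⟩
      b + b * length xs                              ≡⟨ sym (*-suc b _) ⟩
      b * suc (length xs)                            ∎
      where open ≤-Reasoning

    length-concatMap-≤′ : ∀ {b} xs → (∀ {x} → x ∈ xs → length (f x) ≤ b) → length (concatMap f xs) ≤ b * length xs
    length-concatMap-≤′ xs bounded =
      ≤-trans (≤-reflexive (sym (*-identityˡ _)))
              (length-concatMap-≤ {1} xs (λ x∈xs → ≤-trans (≤-reflexive (*-identityˡ _)) (bounded x∈xs)))

  module _ {B : Set} (f : A → List B) where

    ∈-concatMap⁺′ : ∀ {xs x y} → x ∈ xs → y ∈ f x → y ∈ concatMap f xs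
    ∈-concatMap⁺′ {xs} x∈xs y∈fx = ∈-concatMap⁺ f {xs = xs} (Any-map (λ { refl → y∈fx }) x∈xs)

    ∈-concatMap⁻′ : ∀ xs {y} → y ∈ concatMap f xs → ∃ λ x → x ∈ xs × y ∈ f x
    ∈-concatMap⁻′ xs y∈ = find (∈-concatMap⁻ f {xs = xs} y∈)

  sum-map-mono : ∀ {f g : A → ℕ} xs → (∀ {x} → x ∈ xs → f x ≤ g x) → sum (map f xs) ≤ sum (map g xs)
  sum-map-mono []       _  = z≤n
  sum-map-mono (x ∷ xs) f≤g = +-mono-≤ (f≤g (here refl)) (sum-map-mono xs (f≤g ∘ there))

  sum-map-+ : ∀ (f g : A → ℕ) xs → sum (map (λ x → f x + g x) xs) ≡ sum (map f xs) + sum (map g xs)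
  sum-map-+ f g []       = refl
  sum-map-+ f g (x ∷ xs) =
    trans (cong (f x + g x +_) (sum-map-+ f g xs)) (+-interchange (f x) (g x) _ _)

  sum-map-const : ∀ c (xs : List A) → sum (map (λ _ → c) xs) ≡ c * length xs
  sum-map-const c []       = sym (*-zeroʳ c)
  sum-map-const c (x ∷ xs) = trans (cong (c +_) (sum-map-const c xs)) (sym (*-suc c (length xs)))

  ∃-below-average : ∀ (f : A → ℕ) c {x} xs → sum (map f (x ∷ xs)) ≤ c * length (x ∷ xs) →
    ∃ λ y → y ∈ x ∷ xs × f y ≤ c
  ∃-below-average f c {x} xs Σ≤ with f x ≤? c
  ... | yes fx≤c = x , here refl , fx≤c
  ∃-below-average f c {x} [] Σ≤ | no fx≰c =
    ⊥-elim (fx≰c (≤-trans (m≤m+n (f x) 0) (≤-trans Σ≤ (≤-reflexive (*-identityʳ c)))))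
  ∃-below-average f c {x} (y ∷ ys) Σ≤ | no fx≰c =
    let z , z∈ , fz≤c = ∃-below-average f c ys rest≤ in z , there z∈ , fz≤c
    where
    open ≤-Reasoning
    rest≤ : sum (map f (y ∷ ys)) ≤ c * length (y ∷ ys)
    rest≤ = +-cancelˡ-≤ c _ _ (begin
      c + sum (map f (y ∷ ys))   ≤⟨ +-monoˡ-≤ _ (<⇒≤ (≰⇒> fx≰c)) ⟩
      f x + sum (map f (y ∷ ys)) ≤⟨ Σ≤ ⟩
      c * suc (length (y ∷ ys))  ≡⟨ *-suc c _ ⟩
      c + c * length (y ∷ ys)    ∎)

sum-map-swap : ∀ {A B : Set} (h : A → B → ℕ) xs ys →
  sum (map (λ x → sum (map (h x) ys)) xs) ≡ sum (map (λ y → sum (map (λ x → h x y) xs)) ys)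
sum-map-swap h []       ys = sym (sum-map-const 0 ys)
sum-map-swap h (x ∷ xs) ys = trans (cong (sum (map (h x) ys) +_) (sum-map-swap h xs ys))
                                   (sym (sum-map-+ (h x) _ ys))

indicator : ∀ {P : Set} → Dec P → ℕ
indicator (yes _) = 1
indicator (no _)  = 0

length-filter≡sum : ∀ {A : Set} {P : Pred A 0ℓ} (P? : Decidable P) xs →
  length (filter P? xs) ≡ sum (map (indicator ∘ P?) xs)
length-filter≡sum P? []       = refl
length-filter≡sum P? (x ∷ xs) with P? x
... | yes _ = cong suc (length-filter≡sum P? xs)
... | no _  = length-filter≡sum P? xs

double-counting : ∀ {A B : Set} {R : A → B → Set} (R? : ∀ x y → Dec (R x y)) xs ys →
  sum (map (λ x → length (filter (R? x) ys)) xs) ≡ sum (map (λ y → length (filter (λ x → R? x y) xs)) ys)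
double-counting R? xs ys = begin
  sum (map (λ x → length (filter (R? x) ys)) xs)
    ≡⟨ cong sum (map-cong (λ x → length-filter≡sum (R? x) ys) xs) ⟩
  sum (map (λ x → sum (map (λ y → indicator (R? x y)) ys)) xs)
    ≡⟨ sum-map-swap (λ x y → indicator (R? x y)) xs ys ⟩
  sum (map (λ y → sum (map (λ x → indicator (R? x y)) xs)) ys)
    ≡⟨ cong sum (map-cong (λ y → sym (length-filter≡sum (λ x → R? x y) xs)) ys) ⟩
  sum (map (λ y → length (filter (λ x → R? x y) xs)) ys) ∎
  where open ≡-Reasoning

_∈ˡ?_ : ∀ {n} (v : Fin n) vs → Dec (v ∈ vs)
v ∈ˡ? vs = any? (v ≟_) vs

module _ {n : ℕ} {I : Set} (B : I → Fin n → Set) {S : Fin n → Set} where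

  Witnesses : ℕ → I → Set
  Witnesses c i = Σ (List (Fin n)) λ ws → Unique ws × c ≤ length ws × (∀ {v} → v ∈ ws → B i v × S v)

  module _ (B-disjoint : ∀ {i j} → i ≢ j → ∀ {v} → B i v → B j v → ⊥) (c : I → ℕ) where

    private
      gather : ∀ {J} → Unique J → All (λ i → Witnesses (c i) i) J →
        Σ (List (Fin n)) λ ws → Unique ws × sum (map c J) ≤ length ws × (∀ {v} → v ∈ ws → S v × ∃ λ i → i ∈ J × B i v)
      gather [] [] = [] , [] , z≤n , λ ()
      gather {i ∷ J} (i∉J ∷ J!) ((ws , ws! , c≤ , ws⊆) ∷ wss) with vs , vs! , Σ≤ , vs⊆ ← gather J! wss =
        ws ++ vs , ++⁺ ws! vs! apart , ≤-trans (+-mono-≤ c≤ Σ≤) (≤-reflexive (sym (length-++ ws))) , ⊆ws++vs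
        where
        apart : ∀ {v} → v ∈ ws × v ∈ vs → ⊥
        apart (v∈ws , v∈vs) with _ , j , j∈J , Bjv ← vs⊆ v∈vs = B-disjoint (All.lookup i∉J j∈J) (proj₁ (ws⊆ v∈ws)) Bjv
        ⊆ws++vs : ∀ {v} → v ∈ ws ++ vs → S v × ∃ λ j → j ∈ i ∷ J × B j v
        ⊆ws++vs v∈ with ∈-++⁻ ws v∈
        ... | inj₁ v∈ws = proj₂ (ws⊆ v∈ws) , i , here refl , proj₁ (ws⊆ v∈ws)
        ... | inj₂ v∈vs with Sv , j , j∈J , Bjv ← vs⊆ v∈vs = Sv , j , there j∈J , Bjv

    witnesses-bound : ∀ {d} → CardLe S d → ∀ {J} → Unique J → All (λ i → Witnesses (c i) i) J → sum (map c J) ≤ d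
    witnesses-bound bounded J! wss with ws , ws! , Σ≤ , ws⊆ ← gather J! wss = ≤-trans Σ≤ (bounded ws ws! (proj₁ ∘ ws⊆))

-- Independent sets in sparse digraphs

module Independent {N : ℕ} (O : Fin N → List (Fin N)) (D : ℕ) (sparse : ∀ i → 2 * length (O i) ≤ D) where

  -- The graph underlying O, made reflexive so that pairwise non-adjacent picks are distinct.
  Adjacent : Fin N → Fin N → Set
  Adjacent i j = j ∈ O i ⊎ i ∈ O j ⊎ j ≡ i

  adjacent? : ∀ i j → Dec (Adjacent i j)
  adjacent? i j = (j ∈ˡ? O i) ⊎-dec (i ∈ˡ? O j) ⊎-dec (j ≟ i)

  Adjacent-sym : ∀ {i j} → Adjacent i j → Adjacent j i
  Adjacent-sym (inj₁ j∈Oi)        = inj₂ (inj₁ j∈Oi)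
  Adjacent-sym (inj₂ (inj₁ i∈Oj)) = inj₁ i∈Oj
  Adjacent-sym (inj₂ (inj₂ j≡i))  = inj₂ (inj₂ (sym j≡i))

  degree : List (Fin N) → Fin N → ℕ
  degree S i = length (filter (adjacent? i) S)

  in-degree : List (Fin N) → Fin N → ℕ
  in-degree S i = length (filter (λ j → i ∈ˡ? O j) S)

  degree≤ : ∀ {S} → Unique S → ∀ i → degree S i ≤ length (O i) + (in-degree S i + 1)
  degree≤ {S} S! i = begin
    degree S i
      ≤⟨ length-filter-∪ (λ j → j ∈ˡ? O i) (λ j → (i ∈ˡ? O j) ⊎-dec (j ≟ i)) S ⟩
    length (filter (λ j → j ∈ˡ? O i) S) + length (filter (λ j → (i ∈ˡ? O j) ⊎-dec (j ≟ i)) S)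
      ≤⟨ +-mono-≤ out≤ (length-filter-∪ (λ j → i ∈ˡ? O j) (_≟ i) S) ⟩
    length (O i) + (in-degree S i + length (filter (_≟ i) S))
      ≤⟨ +-monoʳ-≤ (length (O i)) (+-monoʳ-≤ (in-degree S i) self≤1) ⟩
    length (O i) + (in-degree S i + 1) ∎
    where
    open ≤-Reasoning
    out≤ : length (filter (λ j → j ∈ˡ? O i) S) ≤ length (O i)
    out≤ = Unique⇒length≤ (filter⁺ (λ j → j ∈ˡ? O i) S!) (λ j∈ → proj₂ (∈-filter⁻ (λ j → j ∈ˡ? O i) {xs = S} j∈))
    self≤1 : length (filter (_≟ i) S) ≤ 1
    self≤1 = all-equal⇒length≤1 (filter⁺ (_≟ i) S!)
      (λ x∈ y∈ → trans (proj₂ (∈-filter⁻ (_≟ i) {xs = S} x∈)) (sym (proj₂ (∈-filter⁻ (_≟ i) {xs = S} y∈))))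

  degree-sum≤ : ∀ {S} → Unique S → sum (map (degree S) S) ≤ (D + 1) * length S
  degree-sum≤ {S} S! = begin
    sum (map (degree S) S)
      ≤⟨ sum-map-mono S (λ {i} _ → degree≤ S! i) ⟩
    sum (map (λ i → length (O i) + (in-degree S i + 1)) S)
      ≡⟨ trans (sum-map-+ _ _ S) (cong (sum (map o S) +_) (sum-map-+ _ _ S)) ⟩
    sum (map o S) + (sum (map (in-degree S) S) + sum (map (λ _ → 1) S))
      ≡⟨ cong (λ m → sum (map o S) + (m + sum (map (λ _ → 1) S))) (double-counting (λ i j → i ∈ˡ? O j) S S) ⟩
    sum (map o S) + (sum (map (λ j → length (filter (_∈ˡ? O j) S)) S) + sum (map (λ _ → 1) S))
      ≤⟨ +-monoʳ-≤ (sum (map o S)) (+-monoˡ-≤ _ (sum-map-mono S (λ {j} _ → in-O≤ j))) ⟩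
    sum (map o S) + (sum (map o S) + sum (map (λ _ → 1) S))
      ≡⟨ trans (sym (+-assoc (sum (map o S)) _ _)) (cong (_+ sum (map (λ _ → 1) S)) (sym (sum-map-+ o o S))) ⟩
    sum (map (λ i → o i + o i) S) + sum (map (λ _ → 1) S)
      ≤⟨ +-monoˡ-≤ _ (sum-map-mono S (λ {i} _ → ≤-trans (≤-reflexive (cong (o i +_) (sym (+-identityʳ (o i))))) (sparse i))) ⟩
    sum (map (λ _ → D) S) + sum (map (λ _ → 1) S)
      ≡⟨ trans (cong₂ _+_ (sum-map-const D S) (sum-map-const 1 S)) (sym (*-distribʳ-+ (length S) D 1)) ⟩
    (D + 1) * length S ∎
    where
    open ≤-Reasoning
    o : Fin N → ℕ
    o i = length (O i)
    in-O≤ : ∀ j → length (filter (_∈ˡ? O j) S) ≤ o j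
    in-O≤ j = Unique⇒length≤ (filter⁺ (_∈ˡ? O j) S!) (λ i∈ → proj₂ (∈-filter⁻ (_∈ˡ? O j) {xs = S} i∈))

  record IndependentSet (s : ℕ) (S : Fin N → Set) : Set where
    field
      pick        : Fin s → Fin N
      pick∈       : ∀ x → S (pick x)
      nonadjacent : ∀ {x y} → x ≢ y → ¬ Adjacent (pick x) (pick y)

  -- Greedy step: the closed degrees in S add up to at most (D + 1)|S|, so some i has closed degree
  -- at most D + 1; keep i and discard its neighbours.
  independent-in : ∀ s S → Unique S → (D + 1) * s ≤ length S + D → IndependentSet s (_∈ S)
  independent-in zero S _ _ = record { pick = λ () ; pick∈ = λ () ; nonadjacent = λ { {()} } }
  independent-in (suc s) [] _ large = ⊥-elim (<⇒≱ D<[D+1]*[1+s] large)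
    where
    D<[D+1]*[1+s] : D < (D + 1) * suc s
    D<[D+1]*[1+s] = ≤-trans (≤-reflexive (+-comm 1 D)) (m≤m*n (D + 1) (suc s))
  independent-in (suc s) S@(_ ∷ _) S! large = record
    { pick = pick′ ; pick∈ = pick∈′ ; nonadjacent = nonadjacent′ }
    where
    low : ∃ λ i → i ∈ S × degree S i ≤ D + 1
    low = ∃-below-average (degree S) (D + 1) _ (degree-sum≤ S!)
    i : Fin N
    i = proj₁ low
    S′ : List (Fin N)
    S′ = filter (∁? (adjacent? i)) S
    large′ : (D + 1) * s ≤ length S′ + D
    large′ = +-cancelˡ-≤ (D + 1) _ _ (begin
      D + 1 + (D + 1) * s            ≡⟨ sym (*-suc (D + 1) s) ⟩
      (D + 1) * suc s                ≤⟨ large ⟩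
      length S + D                   ≡⟨ cong (_+ D) (sym (length-filter+filter∁ (adjacent? i) S)) ⟩
      degree S i + length S′ + D     ≤⟨ +-monoˡ-≤ D (+-monoˡ-≤ (length S′) (proj₂ (proj₂ low))) ⟩
      D + 1 + length S′ + D          ≡⟨ +-assoc (D + 1) (length S′) D ⟩
      D + 1 + (length S′ + D)        ∎)
      where open ≤-Reasoning
    open IndependentSet (independent-in s S′ (filter⁺ (∁? (adjacent? i)) S!) large′)
    far : ∀ x → ¬ Adjacent i (pick x)
    far x = proj₂ (∈-filter⁻ (∁? (adjacent? i)) (pick∈ x))
    pick′ : Fin (suc s) → Fin N
    pick′ zero    = i
    pick′ (suc x) = pick x
    pick∈′ : ∀ x → pick′ x ∈ S
    pick∈′ zero    = proj₁ (proj₂ low)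
    pick∈′ (suc x) = proj₁ (∈-filter⁻ (∁? (adjacent? i)) (pick∈ x))
    nonadjacent′ : ∀ {x y} → x ≢ y → ¬ Adjacent (pick′ x) (pick′ y)
    nonadjacent′ {zero}  {zero}  x≢y = ⊥-elim (x≢y refl)
    nonadjacent′ {zero}  {suc y} _   = far y
    nonadjacent′ {suc x} {zero}  _   = far x ∘ Adjacent-sym
    nonadjacent′ {suc x} {suc y} x≢y = nonadjacent (x≢y ∘ cong suc)

  independent-avoiding : ∀ s {f} (F : List (Fin N)) → length F ≤ f → (D + 1) * (s ∸ 1) + 1 + f ≤ N →
    IndependentSet s (_∉ F)
  independent-avoiding s {f} F |F|≤f large = record
    { pick = pick ; pick∈ = λ x → proj₂ (∈-filter⁻ (∁? (_∈ˡ? F)) {xs = allFin N} (pick∈ x)) ; nonadjacent = nonadjacent }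
    where
    allowed : List (Fin N)
    allowed = filter (∁? (_∈ˡ? F)) (allFin N)
    inside≤f : length (filter (_∈ˡ? F) (allFin N)) ≤ f
    inside≤f = ≤-trans (Unique⇒length≤ (filter⁺ (_∈ˡ? F) (allFin⁺ N))
                                       (λ v∈ → proj₂ (∈-filter⁻ (_∈ˡ? F) {xs = allFin N} v∈)))
                       |F|≤f
    rounded : ∀ s → (D + 1) * s ≤ (D + 1) * (s ∸ 1) + 1 + D
    rounded zero    = ≤-trans (≤-reflexive (*-zeroʳ (D + 1))) z≤n
    rounded (suc s) = ≤-reflexive (trans (*-suc (D + 1) s) (rearrange D ((D + 1) * s)))
      where
      rearrange : ∀ D m → D + 1 + m ≡ m + 1 + D
      rearrange = solve-∀
    large′ : (D + 1) * s ≤ length allowed + D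
    large′ = +-cancelʳ-≤ f _ _ (begin
      (D + 1) * s + f                                       ≤⟨ +-monoˡ-≤ f (rounded s) ⟩
      (D + 1) * (s ∸ 1) + 1 + D + f                         ≡⟨ [x+y]+z≡[x+z]+y _ D f ⟩
      (D + 1) * (s ∸ 1) + 1 + f + D                         ≤⟨ +-monoˡ-≤ D large ⟩
      N + D                                                 ≡⟨ cong (_+ D) N≡ ⟩
      length (filter (_∈ˡ? F) (allFin N)) + length allowed + D ≤⟨ +-monoˡ-≤ D (+-monoˡ-≤ _ inside≤f) ⟩
      f + length allowed + D                                ≡⟨ trans (+-assoc f _ D) (+-comm f _) ⟩
      length allowed + D + f                                ∎)
      where
      open ≤-Reasoning
      N≡ : N ≡ length (filter (_∈ˡ? F) (allFin N)) + length allowed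
      N≡ = sym (trans (length-filter+filter∁ (_∈ˡ? F) (allFin N)) (length-tabulate (λ v → v)))
    open IndependentSet (independent-in s allowed (filter⁺ (∁? (_∈ˡ? F)) (allFin⁺ N)) large′)

∣p∪q∣≤∣p∣+∣q∣ : ∀ {n} (p q : Subset n) → ∣ p ∪ q ∣ ≤ ∣ p ∣ + ∣ q ∣
∣p∪q∣≤∣p∣+∣q∣ []            []            = z≤n
∣p∪q∣≤∣p∣+∣q∣ (outside ∷ p) (outside ∷ q) = ∣p∪q∣≤∣p∣+∣q∣ p q
∣p∪q∣≤∣p∣+∣q∣ (outside ∷ p) (inside  ∷ q) = ≤-trans (s≤s (∣p∪q∣≤∣p∣+∣q∣ p q)) (≤-reflexive (sym (+-suc _ _)))
∣p∪q∣≤∣p∣+∣q∣ (inside  ∷ p) (outside ∷ q) = s≤s (∣p∪q∣≤∣p∣+∣q∣ p q)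
∣p∪q∣≤∣p∣+∣q∣ (inside  ∷ p) (inside  ∷ q) = s≤s (≤-trans (∣p∪q∣≤∣p∣+∣q∣ p q) (+-monoʳ-≤ _ (n≤1+n _)))

fromList : ∀ {n} → List (Fin n) → Subset n
fromList []       = ⊥ₛ
fromList (v ∷ vs) = ⁅ v ⁆ ∪ fromList vs

∈-fromList⁺ : ∀ {n} {v : Fin n} {vs} → v ∈ vs → v ∈ₛ fromList vs
∈-fromList⁺ (here refl)  = x∈p∪q⁺ (inj₁ (x∈⁅x⁆ _))
∈-fromList⁺ (there v∈vs) = x∈p∪q⁺ (inj₂ (∈-fromList⁺ v∈vs))

∈-fromList⁻ : ∀ {n} {v : Fin n} vs → v ∈ₛ fromList vs → v ∈ vs
∈-fromList⁻ []       v∈ = ⊥-elim (∉⊥ v∈)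
∈-fromList⁻ (w ∷ ws) v∈ with x∈p∪q⁻ ⁅ w ⁆ (fromList ws) v∈
... | inj₁ v∈⁅w⁆ = here (x∈⁅y⁆⇒x≡y w v∈⁅w⁆)
... | inj₂ v∈ws  = there (∈-fromList⁻ ws v∈ws)

∣fromList∣≤length : ∀ {n} (vs : List (Fin n)) → ∣ fromList vs ∣ ≤ length vs
∣fromList∣≤length {n} []       = ≤-reflexive (∣⊥∣≡0 n)
∣fromList∣≤length (v ∷ vs) = ≤-trans (∣p∪q∣≤∣p∣+∣q∣ ⁅ v ⁆ (fromList vs))
                                     (≤-trans (+-monoˡ-≤ _ (≤-reflexive (∣⁅x⁆∣≡1 v))) (s≤s (∣fromList∣≤length vs)))

infixr 6 _∪ˡ_
_∪ˡ_ : ∀ {n} → Subset n → List (Fin n) → Subset n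
S ∪ˡ Z = S ∪ fromList Z

∈-∪ˡ⁺ : ∀ {n} (S : Subset n) Z {v} → v ∈ₛ S ⊎ v ∈ Z → v ∈ₛ S ∪ˡ Z
∈-∪ˡ⁺ S Z (inj₁ v∈S) = x∈p∪q⁺ (inj₁ v∈S)
∈-∪ˡ⁺ S Z (inj₂ v∈Z) = x∈p∪q⁺ (inj₂ (∈-fromList⁺ v∈Z))

∈-∪ˡ⁻ : ∀ {n} (S : Subset n) Z {v} → v ∈ₛ S ∪ˡ Z → v ∈ₛ S ⊎ v ∈ Z
∈-∪ˡ⁻ S Z v∈ with x∈p∪q⁻ S (fromList Z) v∈
... | inj₁ v∈S = inj₁ v∈S
... | inj₂ v∈Z = inj₂ (∈-fromList⁻ Z v∈Z)

∪ˡ-mono : ∀ {n} {S S′ : Subset n} {Z Z′} → S ⊆ₛ S′ → Z ⊆ Z′ → S ∪ˡ Z ⊆ₛ S′ ∪ˡ Z′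
∪ˡ-mono {S = S} {S′} {Z} {Z′} S⊆S′ Z⊆Z′ v∈ = ∈-∪ˡ⁺ S′ Z′ (Sum.map S⊆S′ Z⊆Z′ (∈-∪ˡ⁻ S Z v∈))

∣∪ˡ∣≤ : ∀ {n} (S : Subset n) Z → ∣ S ∪ˡ Z ∣ ≤ ∣ S ∣ + length Z
∣∪ˡ∣≤ S Z = ≤-trans (∣p∪q∣≤∣p∣+∣q∣ S (fromList Z)) (+-monoʳ-≤ ∣ S ∣ (∣fromList∣≤length Z))

elements : ∀ {n} → Subset n → List (Fin n)
elements []            = []
elements (inside  ∷ p) = zero ∷ map suc (elements p)
elements (outside ∷ p) = map suc (elements p)

∈-elements⁺ : ∀ {n} {p : Subset n} {v} → v ∈ₛ p → v ∈ elements p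
∈-elements⁺ {p = inside  ∷ p} here       = here refl
∈-elements⁺ {p = inside  ∷ p} (there v∈) = there (∈-map⁺ suc (∈-elements⁺ v∈))
∈-elements⁺ {p = outside ∷ p} (there v∈) = ∈-map⁺ suc (∈-elements⁺ v∈)

∈-elements⁻ : ∀ {n} (p : Subset n) {v} → v ∈ elements p → v ∈ₛ p
∈-elements⁻ (inside  ∷ p) (here refl) = here
∈-elements⁻ (inside  ∷ p) (there v∈) with _ , w∈ , refl ← ∈-map⁻ suc v∈ = there (∈-elements⁻ p w∈)
∈-elements⁻ (outside ∷ p) v∈         with _ , w∈ , refl ← ∈-map⁻ suc v∈ = there (∈-elements⁻ p w∈)

length-elements : ∀ {n} (p : Subset n) → length (elements p) ≡ ∣ p ∣
length-elements []            = refl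
length-elements (inside  ∷ p) = cong suc (trans (length-map suc (elements p)) (length-elements p))
length-elements (outside ∷ p) = trans (length-map suc (elements p)) (length-elements p)

-- Disjoint subfamilies of enlarged sets

module DisjointSubfamily {n N : ℕ} (B : Fin N → Subset n) (B-disjoint : ∀ i j → i ≢ j → Disjoint (B i) (B j))
                         (Z : Fin N → List (Fin n)) where

  owner-unique : ∀ {i j w} → w ∈ₛ B i → w ∈ₛ B j → i ≡ j
  owner-unique {i} {j} w∈Bi w∈Bj with i ≟ j
  ... | yes i≡j = i≡j
  ... | no  i≢j = ⊥-elim (B-disjoint i j i≢j w∈Bi w∈Bj)

  Touches : Fin N → Fin n → Fin N → Set
  Touches i w j = (j ≢ i × w ∈ₛ B j) ⊎ (j ≢ i × w ∈ Z j)

  touches? : ∀ i w j → Dec (Touches i w j)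
  touches? i w = (λ j → ¬? (j ≟ i) ×-dec (w ∈? B j)) ∪? (λ j → ¬? (j ≟ i) ×-dec (w ∈ˡ? Z j))

  carriers : Fin n → List (Fin N)
  carriers w = filter (λ j → w ∈ˡ? Z j) (allFin N)

  -- Enlarged sets B i ∪ Z i and B j ∪ Z j can only meet in a vertex of Z i or of Z j.
  conflicts : Fin N → List (Fin N)
  conflicts i = concatMap (λ w → filter (touches? i w) (allFin N)) (Z i)

  in-conflicts : ∀ {i j w} → w ∈ Z i → Touches i w j → j ∈ conflicts i
  in-conflicts {i} {j} {w} w∈Zi touch =
    ∈-concatMap⁺′ (λ w → filter (touches? i w) (allFin N)) w∈Zi (∈-filter⁺ (touches? i w) (∈-allFin j) touch)

  conflict : ∀ {i j v} → v ∈ₛ B i ∪ˡ Z i → v ∈ₛ B j ∪ˡ Z j → j ∈ conflicts i ⊎ i ∈ conflicts j ⊎ j ≡ i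
  conflict {i} {j} {v} v∈i v∈j with j ≟ i
  ... | yes j≡i = inj₂ (inj₂ j≡i)
  ... | no  j≢i with ∈-∪ˡ⁻ (B i) (Z i) v∈i | ∈-∪ˡ⁻ (B j) (Z j) v∈j
  ...   | inj₁ v∈Bi | inj₁ v∈Bj = ⊥-elim (B-disjoint i j (j≢i ∘ sym) v∈Bi v∈Bj)
  ...   | inj₁ v∈Bi | inj₂ v∈Zj = inj₂ (inj₁ (in-conflicts v∈Zj (inj₁ ((j≢i ∘ sym) , v∈Bi))))
  ...   | inj₂ v∈Zi | inj₁ v∈Bj = inj₁ (in-conflicts v∈Zi (inj₁ (j≢i , v∈Bj)))
  ...   | inj₂ v∈Zi | inj₂ v∈Zj = inj₁ (in-conflicts v∈Zi (inj₂ (j≢i , v∈Zj)))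

  touching≤carriers : ∀ {i w} → w ∈ Z i → length (filter (touches? i w) (allFin N)) ≤ length (carriers w)
  touching≤carriers {i} {w} w∈Zi = begin
    length (filter (touches? i w) (allFin N))                           ≤⟨ length-filter-∪ _ _ (allFin N) ⟩
    length (filter owned? (allFin N)) + length (filter carried? (allFin N)) ≤⟨ +-monoˡ-≤ _ owned≤1 ⟩
    suc (length (filter carried? (allFin N)))                           ≤⟨ Unique⇒length≤ i∷carried! i∷carried⊆ ⟩
    length (carriers w)                                                 ∎
    where
    open ≤-Reasoning
    owned? : ∀ j → Dec (j ≢ i × w ∈ₛ B j)
    owned? j = ¬? (j ≟ i) ×-dec (w ∈? B j)
    carried? : ∀ j → Dec (j ≢ i × w ∈ Z j)
    carried? j = ¬? (j ≟ i) ×-dec (w ∈ˡ? Z j)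
    owned≤1 : length (filter owned? (allFin N)) ≤ 1
    owned≤1 = all-equal⇒length≤1 (filter⁺ owned? (allFin⁺ N)) λ j∈ k∈ →
      owner-unique (proj₂ (proj₂ (∈-filter⁻ owned? {xs = allFin N} j∈)))
                   (proj₂ (proj₂ (∈-filter⁻ owned? {xs = allFin N} k∈)))
    i∷carried! : Unique (i ∷ filter carried? (allFin N))
    i∷carried! = All.tabulate (λ j∈ i≡j → proj₁ (proj₂ (∈-filter⁻ carried? {xs = allFin N} j∈)) (sym i≡j))
               ∷ filter⁺ carried? (allFin⁺ N)
    i∷carried⊆ : i ∷ filter carried? (allFin N) ⊆ carriers w
    i∷carried⊆ (here refl) = ∈-filter⁺ (λ j → w ∈ˡ? Z j) (∈-allFin i) w∈Zi
    i∷carried⊆ (there j∈) = ∈-filter⁺ (λ j → w ∈ˡ? Z j) (∈-allFin _)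
                                       (proj₂ (proj₂ (∈-filter⁻ carried? {xs = allFin N} j∈)))

  record Subfamily (s : ℕ) (F : List (Fin N)) : Set where
    field
      pick     : Fin s → Fin N
      avoids   : ∀ x → pick x ∉ F
      disjoint : ∀ {x y} → x ≢ y → Disjoint (B (pick x) ∪ˡ Z (pick x)) (B (pick y) ∪ˡ Z (pick y))

  module _ {c d : ℕ} .{{_ : NonZero c}}
           (spread : ∀ w {J} → Unique J → (∀ {j} → j ∈ J → w ∈ Z j) → c * length J ≤ d) where

    conflicts-length : ∀ i → c * length (conflicts i) ≤ d * length (Z i)
    conflicts-length i = length-concatMap-≤ (λ w → filter (touches? i w) (allFin N)) {c} {d} (Z i) λ {w} w∈Zi →
      ≤-trans (*-monoʳ-≤ c (touching≤carriers w∈Zi))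
              (spread w (filter⁺ (λ j → w ∈ˡ? Z j) (allFin⁺ N))
                        (λ j∈ → proj₂ (∈-filter⁻ (λ j → w ∈ˡ? Z j) {xs = allFin N} j∈)))

    abstract
      disjoint-subfamily : ∀ {D} → (∀ i → 2 * (d * length (Z i)) ≤ c * D) →
        ∀ s {f} F → length F ≤ f → (D + 1) * (s ∸ 1) + 1 + f ≤ N → Subfamily s F
      disjoint-subfamily {D} small s F |F|≤f large = record
        { pick = pick ; avoids = pick∈ ; disjoint = λ x≢y v∈x v∈y → nonadjacent x≢y (conflict v∈x v∈y) }
        where
        sparse : ∀ i → 2 * length (conflicts i) ≤ D
        sparse i = *-cancelˡ-≤ c (begin
          c * (2 * length (conflicts i)) ≡⟨ x*[y*z]≡y*[x*z] c 2 _ ⟩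
          2 * (c * length (conflicts i)) ≤⟨ *-monoʳ-≤ 2 (conflicts-length i) ⟩
          2 * (d * length (Z i))         ≤⟨ small i ⟩
          c * D                          ∎)
          where open ≤-Reasoning
        open Independent conflicts D sparse
        open IndependentSet (independent-avoiding s F |F|≤f large)

module _ {V : Set} where

  infix 5 _↾_
  _↾_ : (V → V → Set) → (V → Set) → V → V → Set
  (E ↾ A) u v = A u × A v × E u v

  Walk : (V → V → Set) → (V → Set) → V → V → Set
  Walk E A = Star (E ↾ A)

  Rooted : (V → V → Set) → (V → Set) → V → Set
  Rooted E A r = A r × (∀ {v} → A v → Walk E A v r)

  module _ {E : V → V → Set} where

    walk-mono : ∀ {A A′ : V → Set} → (∀ {v} → A v → A′ v) → ∀ {u w} → Walk E A u w → Walk E A′ u w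
    walk-mono A⊆A′ = Star.map (λ (au , av , e) → A⊆A′ au , A⊆A′ av , e)

    walk-reverse : ∀ {A} → (∀ {u v} → E u v → E v u) → ∀ {u w} → Walk E A u w → Walk E A w u
    walk-reverse E-sym = Star.reverse (λ (au , av , e) → av , au , E-sym e)

    walk-exits : ∀ {A B : V → Set} → (∀ v → Dec (B v)) → ∀ {u w} → Walk E A u w → B u → ¬ B w →
      ∃₂ λ x y → B x × ¬ B y × (E ↾ A) x y
    walk-exits B? ε Bu ¬Bw = ⊥-elim (¬Bw Bu)
    walk-exits B? (_◅_ {j = y} edge walk) Bu ¬Bw with B? y
    ... | yes By = walk-exits B? walk By ¬Bw
    ... | no ¬By = _ , y , Bu , ¬By , edge

module _ {n : ℕ} {E : Fin n → Fin n → Set} where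

  walkIn⇒walk : ∀ {S u w} → WalkIn E S u w → Walk E (_∈ₛ S) u w
  walkIn⇒walk (stop _)           = ε
  walkIn⇒walk (step u∈S e walk) = (u∈S , walkIn-start walk , e) ◅ walkIn⇒walk walk
    where
    walkIn-start : ∀ {S x w} → WalkIn E S x w → x ∈ₛ S
    walkIn-start (stop x∈S)     = x∈S
    walkIn-start (step x∈S _ _) = x∈S

  walk⇒walkIn : ∀ {S u w} → u ∈ₛ S → Walk E (_∈ₛ S) u w → WalkIn E S u w
  walk⇒walkIn u∈S ε                      = stop u∈S
  walk⇒walkIn u∈S ((_ , x∈S , e) ◅ walk) = step u∈S e (walk⇒walkIn x∈S walk)

  rooted⇒connected : (∀ {u v} → E u v → E v u) → ∀ {S r} → Rooted E (_∈ₛ S) r → Connected E S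
  rooted⇒connected E-sym {r = r} (r∈S , reach) =
    (r , r∈S) , λ u∈S w∈S → walk⇒walkIn u∈S (reach u∈S ◅◅ walk-reverse E-sym (reach w∈S))

-- Paths and shortcuts

module _ {A : Set} where

  dropLast-⊆ : ∀ (xs : List A) {v} → v ∈ dropLast xs → v ∈ xs
  dropLast-⊆ (x ∷ y ∷ ys) (here refl) = here refl
  dropLast-⊆ (x ∷ y ∷ ys) (there v∈) = there (dropLast-⊆ (y ∷ ys) v∈)

  length-dropLast : ∀ (xs : List A) → length (dropLast xs) ≡ length xs ∸ 1
  length-dropLast []           = refl
  length-dropLast (x ∷ [])     = refl
  length-dropLast (x ∷ y ∷ ys) = cong suc (length-dropLast (y ∷ ys))

module _ {n : ℕ} where

  lastOf-∈ : ∀ (a : Fin n) xs → 1 ≤ length xs → lastOf a xs ∈ xs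
  lastOf-∈ a (x ∷ [])     _ = here refl
  lastOf-∈ a (x ∷ y ∷ ys) _ = there (lastOf-∈ x (y ∷ ys) (s≤s z≤n))

  ∈-dropLast-or-last : ∀ (a : Fin n) xs {v} → v ∈ xs → v ∈ dropLast xs ⊎ v ≡ lastOf a xs
  ∈-dropLast-or-last a (x ∷ [])     (here refl) = inj₂ refl
  ∈-dropLast-or-last a (x ∷ y ∷ ys) (here refl) = inj₁ (here refl)
  ∈-dropLast-or-last a (x ∷ y ∷ ys) (there v∈) with ∈-dropLast-or-last x (y ∷ ys) v∈
  ... | inj₁ v∈dropLast = inj₁ (there v∈dropLast)
  ... | inj₂ v≡last     = inj₂ v≡last

  module _ {E : Fin n → Fin n → Set} where

    chain-dropLast : ∀ {a} xs → Chain E a xs → Chain E a (dropLast xs)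
    chain-dropLast []           _        = _
    chain-dropLast (x ∷ [])     _        = _
    chain-dropLast (x ∷ y ∷ ys) (e , ch) = e , chain-dropLast (y ∷ ys) ch

    chain-walk-last : ∀ {a} xs → Chain E a xs → ∀ {v} → v ∈ a ∷ xs → Walk E (_∈ a ∷ xs) v (lastOf a xs)
    chain-walk-last []       _        (here refl) = ε
    chain-walk-last (y ∷ ys) (e , ch) (here refl) =
      (here refl , there (here refl) , e) ◅ walk-mono there (chain-walk-last ys ch (here refl))
    chain-walk-last (y ∷ ys) (e , ch) (there v∈) = walk-mono there (chain-walk-last ys ch v∈)

    chain-walk-first : (∀ {u v} → E u v → E v u) → ∀ {a} xs → Chain E a xs →
      ∀ {v} → v ∈ a ∷ xs → Walk E (_∈ a ∷ xs) v a
    chain-walk-first E-sym xs ch v∈ =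
      chain-walk-last xs ch v∈ ◅◅ walk-reverse E-sym (chain-walk-last xs ch (here refl))

    chain-interior-walk-last : ∀ {a} xs → Chain E a xs → ∀ {v} → v ∈ dropLast xs →
      Walk E (λ z → z ≡ lastOf a xs ⊎ z ∈ dropLast xs) v (lastOf a xs)
    chain-interior-walk-last {a} (y ∷ ys) (_ , ch) v∈ =
      walk-mono (Sum.swap ∘ ∈-dropLast-or-last a (y ∷ ys)) (chain-walk-last ys ch (dropLast-⊆ (y ∷ ys) v∈))

    chain-interior-walk-first : (∀ {u v} → E u v → E v u) → ∀ {a} xs → Chain E a xs → ∀ {v} → v ∈ dropLast xs →
      Walk E (λ z → z ≡ a ⊎ z ∈ dropLast xs) v a
    chain-interior-walk-first E-sym xs ch v∈ =
      walk-mono first-or-interior (chain-walk-first E-sym (dropLast xs) (chain-dropLast xs ch) (there v∈))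
      where
      first-or-interior : ∀ {a z} → z ∈ a ∷ dropLast xs → z ≡ a ⊎ z ∈ dropLast xs
      first-or-interior (here z≡a) = inj₁ z≡a
      first-or-interior (there z∈) = inj₂ z∈

module Paths {n : ℕ} (G : Graph n) where

  open Graph G using (E) renaming (sym to E-sym)

  vertices : Path G → List (Fin n)
  vertices P = Path.first P ∷ Path.rest P

  interior : Path G → List (Fin n)
  interior P = dropLast (Path.rest P)

  -- AugE G 𝒫 u v unfolds to E u v ⊎ Σ P (P ∈ 𝒫 × Joins P u v).
  Joins : Path G → Fin n → Fin n → Set
  Joins P u w = (endA P ≡ u × endB P ≡ w) ⊎ (endA P ≡ w × endB P ≡ u)

  module _ (P : Path G) where

    Joins-sym : ∀ {u w} → Joins P u w → Joins P w u
    Joins-sym = Sum.swap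

    endB∈rest : endB P ∈ Path.rest P
    endB∈rest = lastOf-∈ (Path.first P) (Path.rest P) (Path.nonTriv P)

    endA≢endB : endA P ≢ endB P
    endA≢endB with Path.distinct P
    ... | first∉rest ∷ _ = All.lookup first∉rest endB∈rest

    start∈vertices : ∀ {u w} → Joins P u w → u ∈ vertices P
    start∈vertices (inj₁ (refl , _)) = here refl
    start∈vertices (inj₂ (_ , refl)) = there endB∈rest

    start-is-end : ∀ {u w} → Joins P u w → endA P ≡ u ⊎ endB P ≡ u
    start-is-end = Sum.map proj₁ proj₂

    end-cases : ∀ {u w v} → Joins P u w → v ≡ endA P ⊎ v ≡ endB P → v ≡ u ⊎ v ≡ w
    end-cases (inj₁ (A≡u , _)) (inj₁ v≡A) = inj₁ (trans v≡A A≡u)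
    end-cases (inj₁ (_ , B≡w)) (inj₂ v≡B) = inj₂ (trans v≡B B≡w)
    end-cases (inj₂ (A≡w , _)) (inj₁ v≡A) = inj₂ (trans v≡A A≡w)
    end-cases (inj₂ (_ , B≡u)) (inj₂ v≡B) = inj₁ (trans v≡B B≡u)

    vertex-cases : ∀ {u w v} → Joins P u w → v ∈ vertices P → v ≡ u ⊎ Internal v P ⊎ v ≡ w
    vertex-cases joins (here v≡A) = Sum.map₂ inj₂ (end-cases joins (inj₁ v≡A))
    vertex-cases joins (there v∈rest) with ∈-dropLast-or-last (Path.first P) (Path.rest P) v∈rest
    ... | inj₁ v∈interior = inj₂ (inj₁ v∈interior)
    ... | inj₂ v≡B        = Sum.map₂ inj₂ (end-cases joins (inj₂ v≡B))

    walk-to-start : ∀ {u w v} → Joins P u w → v ∈ vertices P → Walk E (_∈ vertices P) v u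
    walk-to-start (inj₁ (refl , _)) = chain-walk-first E-sym (Path.rest P) (Path.chain P)
    walk-to-start (inj₂ (_ , refl)) = chain-walk-last (Path.rest P) (Path.chain P)

    walk-along : ∀ {u w} → Joins P u w → Walk E (_∈ vertices P) u w
    walk-along joins = walk-to-start (Joins-sym joins) (start∈vertices joins)

    interior-walk : ∀ {u w v} → Joins P u w → Internal v P → Walk E (λ z → z ≡ w ⊎ Internal z P) v w
    interior-walk (inj₁ (_ , refl)) = chain-interior-walk-last (Path.rest P) (Path.chain P)
    interior-walk (inj₂ (refl , _)) = chain-interior-walk-first E-sym (Path.rest P) (Path.chain P)

  length-interior : ∀ {k} (P : Path G) → len P ≤ k → length (interior P) ≤ k ∸ 1
  length-interior P short = ≤-trans (≤-reflexive (length-dropLast (Path.rest P))) (∸-monoˡ-≤ 1 short)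

module Shortcuts {n : ℕ} (G : Graph n) (𝒫 : ShortcutSystem G) {k : ℕ} (short : ∀ {P} → P ∈ 𝒫 → len P ≤ k) where

  open Graph G using (E) renaming (sym to E-sym)
  open Paths G

  AugE-sym : ∀ {u v} → AugE G 𝒫 u v → AugE G 𝒫 v u
  AugE-sym (inj₁ e)                 = inj₁ (E-sym e)
  AugE-sym (inj₂ (P , P∈𝒫 , joins)) = inj₂ (P , P∈𝒫 , Joins-sym P joins)

  record Detour (u x : Fin n) : Set where
    field
      W              : List (Fin n)
      W-length       : length W ≤ k ∸ 1
      W-interior     : ∀ {z} → z ∈ W → ∃ λ P → P ∈ 𝒫 × Internal z P × Joins P u x
      reach-interior : ∀ {v} → v ∈ W → Walk E (λ z → z ≡ u ⊎ z ∈ W) v u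
      reach-end      : Walk E (λ z → z ≡ u ⊎ z ∈ W ⊎ z ≡ x) x u

  abstract
    detour : ∀ {u x} → AugE G 𝒫 u x → Detour u x
    detour (inj₁ e) = record
      { W = [] ; W-length = z≤n ; W-interior = λ () ; reach-interior = λ ()
      ; reach-end = (inj₂ (inj₂ refl) , inj₁ refl , E-sym e) ◅ ε }
    detour {u} {x} (inj₂ (P , P∈𝒫 , joins)) = record
      { W              = interior P
      ; W-length       = length-interior P (short P∈𝒫)
      ; W-interior     = λ z∈ → P , P∈𝒫 , z∈ , joins
      ; reach-interior = interior-walk P (Joins-sym P joins)
      ; reach-end      = walk-mono (vertex-cases P joins) (walk-along P (Joins-sym P joins))
      }

  Bridged : Subset n → Fin n → Set
  Bridged S z = ∃ λ P → P ∈ 𝒫 × Internal z P × endA P ∈ₛ S × endB P ∈ₛ S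

  record Spanner (S : Subset n) : Set where
    field
      Z       : List (Fin n)
      bridged : ∀ {z} → z ∈ Z → Bridged S z
      size    : length Z ≤ (k ∸ 1) * (∣ S ∣ ∸ 1)
      root    : Fin n
      rooted  : Rooted E (_∈ₛ S ∪ˡ Z) root

  module _ {S : Subset n} where

    private
      -- A spanning tree of S in G^𝒫 grown from r, with vertex set R; Z collects the interiors of its
      -- shortcut edges, and size says |Z| ≤ (k − 1)(|R| − 1) without truncated subtraction.
      record Partial (r : Fin n) : Set where
        field
          R       : Subset n
          Z       : List (Fin n)
          R⊆S     : R ⊆ₛ S
          r∈R     : r ∈ₛ R
          bridged : ∀ {z} → z ∈ Z → Bridged S z
          size    : length Z + (k ∸ 1) ≤ (k ∸ 1) * ∣ R ∣
          reach   : ∀ {v} → v ∈ₛ R ∪ˡ Z → Walk E (_∈ₛ R ∪ˡ Z) v r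

      module Attach {r} (T : Partial r) {u x} (u∈R : u ∈ₛ Partial.R T) (x∈S : x ∈ₛ S) (x∉R : x ∉ₛ Partial.R T)
                    (D : Detour u x) where

        open Partial T
        open Detour D

        R′ : Subset n
        R′ = ⁅ x ⁆ ∪ R

        R⊂R′ : ∣ R ∣ < ∣ R′ ∣
        R⊂R′ = p⊂q⇒∣p∣<∣q∣ (q⊆p∪q ⁅ x ⁆ R , x , x∈p∪q⁺ (inj₁ (x∈⁅x⁆ x)) , x∉R)

        R′⊆S : R′ ⊆ₛ S
        R′⊆S v∈R′ = Sum.[ (λ v∈⁅x⁆ → subst (_∈ₛ S) (sym (x∈⁅y⁆⇒x≡y x v∈⁅x⁆)) x∈S) , R⊆S ]′ (x∈p∪q⁻ ⁅ x ⁆ R v∈R′)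

        bridged′ : ∀ {z} → z ∈ W ++ Z → Bridged S z
        bridged′ z∈ with ∈-++⁻ W z∈
        ... | inj₂ z∈Z = bridged z∈Z
        ... | inj₁ z∈W with P , P∈𝒫 , internal , joins ← W-interior z∈W =
          P , P∈𝒫 , internal , end∈S (end-cases P joins (inj₁ refl)) , end∈S (end-cases P joins (inj₂ refl))
          where
          end∈S : ∀ {v} → v ≡ u ⊎ v ≡ x → v ∈ₛ S
          end∈S (inj₁ refl) = R⊆S u∈R
          end∈S (inj₂ refl) = x∈S

        size′ : length (W ++ Z) + (k ∸ 1) ≤ (k ∸ 1) * ∣ R′ ∣
        size′ = begin
          length (W ++ Z) + (k ∸ 1)       ≡⟨ trans (cong (_+ (k ∸ 1)) (length-++ W)) (+-assoc (length W) _ _) ⟩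
          length W + (length Z + (k ∸ 1)) ≤⟨ +-mono-≤ W-length size ⟩
          (k ∸ 1) + (k ∸ 1) * ∣ R ∣       ≡⟨ sym (*-suc (k ∸ 1) ∣ R ∣) ⟩
          (k ∸ 1) * suc ∣ R ∣             ≤⟨ *-monoʳ-≤ (k ∸ 1) R⊂R′ ⟩
          (k ∸ 1) * ∣ R′ ∣                ∎
          where open ≤-Reasoning

        old⊆new : R ∪ˡ Z ⊆ₛ R′ ∪ˡ (W ++ Z)
        old⊆new = ∪ˡ-mono (q⊆p∪q ⁅ x ⁆ R) (∈-++⁺ʳ W)

        detour⊆new : ∀ {v} → v ≡ u ⊎ v ∈ W ⊎ v ≡ x → v ∈ₛ R′ ∪ˡ (W ++ Z)
        detour⊆new (inj₁ refl)        = old⊆new (∈-∪ˡ⁺ R Z (inj₁ u∈R))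
        detour⊆new (inj₂ (inj₁ v∈W))  = ∈-∪ˡ⁺ R′ (W ++ Z) (inj₂ (∈-++⁺ˡ v∈W))
        detour⊆new (inj₂ (inj₂ refl)) = ∈-∪ˡ⁺ R′ (W ++ Z) (inj₁ (x∈p∪q⁺ (inj₁ (x∈⁅x⁆ x))))

        via-u : ∀ {v} → Walk E (_∈ₛ R′ ∪ˡ (W ++ Z)) v u → Walk E (_∈ₛ R′ ∪ˡ (W ++ Z)) v r
        via-u walk = walk ◅◅ walk-mono old⊆new (reach (∈-∪ˡ⁺ R Z (inj₁ u∈R)))

        from-x : ∀ {v} → v ≡ x → Walk E (_∈ₛ R′ ∪ˡ (W ++ Z)) v r
        from-x refl = via-u (walk-mono detour⊆new reach-end)

        reach′ : ∀ {v} → v ∈ₛ R′ ∪ˡ (W ++ Z) → Walk E (_∈ₛ R′ ∪ˡ (W ++ Z)) v r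
        reach′ v∈ with ∈-∪ˡ⁻ R′ (W ++ Z) v∈
        ... | inj₁ v∈R′ = Sum.[ from-x ∘ x∈⁅y⁆⇒x≡y x , (λ v∈R → walk-mono old⊆new (reach (∈-∪ˡ⁺ R Z (inj₁ v∈R)))) ]′
                                (x∈p∪q⁻ ⁅ x ⁆ R v∈R′)
        ... | inj₂ v∈W++Z with ∈-++⁻ W v∈W++Z
        ...   | inj₁ v∈W = via-u (walk-mono (detour⊆new ∘ Sum.map₂ inj₁) (reach-interior v∈W))
        ...   | inj₂ v∈Z = walk-mono old⊆new (reach (∈-∪ˡ⁺ R Z (inj₂ v∈Z)))

        T′ : Partial r
        T′ = record
          { R = R′ ; Z = W ++ Z ; R⊆S = R′⊆S ; r∈R = q⊆p∪q ⁅ x ⁆ R r∈R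
          ; bridged = bridged′ ; size = size′ ; reach = reach′ }

    abstract
      spanner : Connected (AugE G 𝒫) S → Spanner S
      spanner ((r , r∈S) , connected) = grow ∣ S ∣ start (≤-trans (m≤n+m ∣ S ∣ 1) (≤-reflexive (cong (_+ ∣ S ∣) (sym (∣⁅x⁆∣≡1 r)))))
        where
        start : Partial r
        start = record
          { R = ⁅ r ⁆ ; Z = [] ; R⊆S = λ v∈ → subst (_∈ₛ S) (sym (x∈⁅y⁆⇒x≡y r v∈)) r∈S ; r∈R = x∈⁅x⁆ r
          ; bridged = λ () ; size = ≤-reflexive (trans (sym (*-identityʳ (k ∸ 1))) (cong ((k ∸ 1) *_) (sym (∣⁅x⁆∣≡1 r))))
          ; reach = λ v∈ → reach-root (x∈⁅y⁆⇒x≡y r (Sum.[ id , (λ ()) ]′ (∈-∪ˡ⁻ ⁅ r ⁆ [] v∈)))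
          }
          where
          reach-root : ∀ {v} → v ≡ r → Walk E (_∈ₛ ⁅ r ⁆ ∪ˡ []) v r
          reach-root refl = ε

        finish : (T : Partial r) → S ⊆ₛ Partial.R T → Spanner S
        finish T S⊆R = record
          { Z = Z ; bridged = bridged ; size = size′ ; root = r
          ; rooted = ∈-∪ˡ⁺ S Z (inj₁ r∈S) , λ v∈ → walk-mono (∪ˡ-mono {Z = Z} R⊆S id) (reach (∪ˡ-mono {Z = Z} S⊆R id v∈)) }
          where
          open Partial T
          size′ : length Z ≤ (k ∸ 1) * (∣ S ∣ ∸ 1)
          size′ = ≤-trans (m+n≤o⇒m≤o∸n (length Z) (≤-trans size (*-monoʳ-≤ (k ∸ 1) (p⊆q⇒∣p∣≤∣q∣ R⊆S))))
                          (≤-reflexive (sym (trans (*-distribˡ-∸ (k ∸ 1) ∣ S ∣ 1) (cong ((k ∸ 1) * ∣ S ∣ ∸_) (*-identityʳ (k ∸ 1))))))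

        grow : ∀ fuel (T : Partial r) → ∣ S ∣ ≤ ∣ Partial.R T ∣ + fuel → Spanner S
        grow fuel T bound with Fin.any? (λ v → (v ∈? S) ×-dec ¬? (v ∈? Partial.R T))
        ... | no S⊈R = finish T (λ {v} v∈S → decidable-stable (v ∈? Partial.R T) (λ v∉R → S⊈R (v , v∈S , v∉R)))
        ... | yes (v , v∈S , v∉R)
            with u , x , u∈R , x∉R , (_ , x∈S , e) ← walk-exits (_∈? Partial.R T) (walkIn⇒walk (connected r∈S v∈S)) (Partial.r∈R T) v∉R
            with fuel
        ... | zero      = ⊥-elim (<⇒≱ R⊂R′ (≤-trans (p⊆q⇒∣p∣≤∣q∣ R′⊆S) (≤-trans bound (≤-reflexive (+-identityʳ _)))))
          where open Attach T u∈R x∈S x∉R (detour e)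
        ... | suc fuel′ = grow fuel′ T′ (≤-trans bound (≤-trans (≤-reflexive (+-suc _ fuel′)) (+-monoˡ-≤ fuel′ R⊂R′)))
          where open Attach T u∈R x∈S x∉R (detour e)


-- The construction

module Construction (s t d k p q : ℕ) {n : ℕ} (G : Graph n) (𝒫 : ShortcutSystem G) (kd : IsKDStar G k d 𝒫)
                    (model : Model (AugE G 𝒫) (s′ s d k p) (t′ s t d k p q) p q) where

  open Graph G using (E) renaming (sym to E-sym)
  open Model model renaming (X to X′; Y to Y′)
  open Paths G
  open Shortcuts G 𝒫 (proj₁ kd)

  s₁ t₁ K : ℕ
  s₁ = s′ s d k p
  t₁ = t′ s t d k p q
  K  = k ∸ 1

  M-sparse : ∀ w → CardLe (M 𝒫 w) d
  M-sparse = proj₂ kd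

  spanX : ∀ i → Spanner (X′ i)
  spanX i = spanner (connX i)

  ZX : Fin s₁ → List (Fin n)
  ZX i = Spanner.Z (spanX i)

  BX : Fin s₁ → Subset n
  BX i = X′ i ∪ˡ ZX i

  ZX-size : ∀ i → length (ZX i) ≤ K * (p ∸ 1)
  ZX-size i = ≤-trans (Spanner.size (spanX i)) (*-monoʳ-≤ K (∸-monoˡ-≤ 1 (sizeX i)))

  BX-size : ∀ i → ∣ BX i ∣ ≤ p + K * (p ∸ 1)
  BX-size i = ≤-trans (∣∪ˡ∣≤ (X′ i) (ZX i)) (+-mono-≤ (sizeX i) (ZX-size i))

  BX-connected : ∀ i → Connected E (BX i)
  BX-connected i = rooted⇒connected E-sym (Spanner.rooted (spanX i))

  -- The ends of a shortcut through w lie in M_w; as branch sets are disjoint, sets with w in their Z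
  -- contribute distinct ends, which bounds their number (weighted 2 for X, 1 for Y) by d.
  both-ends : ∀ {i w} → w ∈ ZX i → Witnesses (λ i v → v ∈ₛ X′ i) {M 𝒫 w} 2 i
  both-ends {i} w∈ with P , P∈𝒫 , internal , A∈X , B∈X ← Spanner.bridged (spanX i) w∈ =
    endA P ∷ endB P ∷ [] , ((endA≢endB P ∷ []) ∷ [] ∷ []) , ≤-refl , λ
      { (here refl)         → A∈X , P , P∈𝒫 , inj₁ refl , internal
      ; (there (here refl)) → B∈X , P , P∈𝒫 , inj₂ refl , internal }

  ZX-spread : ∀ w {J} → Unique J → (∀ {i} → i ∈ J → w ∈ ZX i) → 2 * length J ≤ d
  ZX-spread w {J} J! J⊆ = ≤-trans (≤-reflexive (sym (sum-map-const 2 J)))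
    (witnesses-bound (λ i v → v ∈ₛ X′ i) (λ i≢j → disjXX _ _ i≢j) (λ _ → 2) (M-sparse w) J! (All.tabulate (both-ends ∘ J⊆)))

  selectX : DisjointSubfamily.Subfamily X′ disjXX ZX s []
  selectX = DisjointSubfamily.disjoint-subfamily X′ disjXX ZX {2} {d} ZX-spread {D = d * K * (p ∸ 1)} small s [] z≤n
                                                 (≤-reflexive (+-identityʳ _))
    where
    small : ∀ i → 2 * (d * length (ZX i)) ≤ 2 * (d * K * (p ∸ 1))
    small i = *-monoʳ-≤ 2 (≤-trans (*-monoʳ-≤ d (ZX-size i)) (≤-reflexive (sym (*-assoc d K (p ∸ 1)))))

  open DisjointSubfamily.Subfamily selectX public using () renaming (pick to gX; disjoint to X-disjoint)

  spanY : ∀ j → Spanner (Y′ j)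
  spanY j = spanner (connY j)

  -- The edge of G^𝒫 between X′ (gX x) and Y′ j, realised by a detour towards its Y-end.
  module Link (x : Fin s) (j : Fin t₁) where
    a b : Fin n
    a = proj₁ (edge (gX x) j)
    b = proj₁ (proj₂ (edge (gX x) j))
    a∈X : a ∈ₛ X′ (gX x)
    a∈X = proj₁ (proj₂ (proj₂ (edge (gX x) j)))
    b∈Y : b ∈ₛ Y′ j
    b∈Y = proj₁ (proj₂ (proj₂ (proj₂ (edge (gX x) j))))
    open Detour (detour (AugE-sym (proj₂ (proj₂ (proj₂ (proj₂ (edge (gX x) j))))))) public

  ZE : Fin t₁ → List (Fin n)
  ZE j = concatMap (λ x → Link.W x j) (allFin s)

  ZY : Fin t₁ → List (Fin n)
  ZY j = Spanner.Z (spanY j) ++ ZE j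

  BY : Fin t₁ → Subset n
  BY j = Y′ j ∪ˡ ZY j

  q-positive : Fin t₁ → 1 ≤ q
  q-positive j with v , v∈Y ← proj₁ (connY j) =
    ≤-trans (≤-reflexive (sym (∣⁅x⁆∣≡1 v)))
            (≤-trans (p⊆q⇒∣p∣≤∣q∣ (λ w∈ → subst (_∈ₛ Y′ j) (sym (x∈⁅y⁆⇒x≡y v w∈)) v∈Y)) (sizeY j))

  ZY-size : ∀ j → length (ZY j) ≤ K * (s + q ∸ 1)
  ZY-size j = begin
    length (Spanner.Z (spanY j) ++ ZE j)   ≡⟨ length-++ (Spanner.Z (spanY j)) ⟩
    length (Spanner.Z (spanY j)) + length (ZE j)
      ≤⟨ +-mono-≤ (≤-trans (Spanner.size (spanY j)) (*-monoʳ-≤ K (∸-monoˡ-≤ 1 (sizeY j))))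
                  (length-concatMap-≤′ (λ x → Link.W x j) (allFin s) (λ {x} _ → Link.W-length x j)) ⟩
    K * (q ∸ 1) + K * length (allFin s)    ≡⟨ sym (*-distribˡ-+ K (q ∸ 1) _) ⟩
    K * (q ∸ 1 + length (allFin s))        ≡⟨ cong (λ m → K * (q ∸ 1 + m)) (length-tabulate (λ x → x)) ⟩
    K * (q ∸ 1 + s)                        ≡⟨ cong (K *_) (trans (+-comm (q ∸ 1) s) (sym (+-∸-assoc s (q-positive j)))) ⟩
    K * (s + q ∸ 1)                        ∎
    where open ≤-Reasoning

  BY-size : ∀ j → ∣ BY j ∣ ≤ q + K * (s + q ∸ 1)
  BY-size j = ≤-trans (∣∪ˡ∣≤ (Y′ j) (ZY j)) (+-mono-≤ (sizeY j) (ZY-size j))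

  BY-connected : ∀ j → Connected E (BY j)
  BY-connected j = rooted⇒connected E-sym (⊆BY (proj₁ rooted) , reach)
    where
    open Spanner (spanY j) using (Z; rooted; root)
    ⊆BY : ∀ {v} → v ∈ₛ Y′ j ∪ˡ Z → v ∈ₛ BY j
    ⊆BY v∈ = ∈-∪ˡ⁺ (Y′ j) (ZY j) (Sum.map₂ ∈-++⁺ˡ (∈-∪ˡ⁻ (Y′ j) Z v∈))
    from-spanner : ∀ {v} → v ∈ₛ Y′ j ⊎ v ∈ Z → Walk E (_∈ₛ BY j) v root
    from-spanner v∈ = walk-mono ⊆BY (proj₂ rooted (∈-∪ˡ⁺ (Y′ j) Z v∈))
    from-link : ∀ {v} → v ∈ ZE j → Walk E (_∈ₛ BY j) v root
    from-link v∈ZE =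
      let x , _ , v∈W = ∈-concatMap⁻′ (λ x → Link.W x j) (allFin s) v∈ZE
      in  walk-mono (⊆BY′ x) (Link.reach-interior x j v∈W) ◅◅ from-spanner (inj₁ (Link.b∈Y x j))
      where
      ⊆BY′ : ∀ x {z} → z ≡ Link.b x j ⊎ z ∈ Link.W x j → z ∈ₛ BY j
      ⊆BY′ x (inj₁ z≡b) = ∈-∪ˡ⁺ (Y′ j) (ZY j) (inj₁ (subst (_∈ₛ Y′ j) (sym z≡b) (Link.b∈Y x j)))
      ⊆BY′ x (inj₂ z∈W) = ∈-∪ˡ⁺ (Y′ j) (ZY j) (inj₂ (∈-++⁺ʳ Z (∈-concatMap⁺′ (λ x → Link.W x j) (∈-allFin x) z∈W)))
    reach : ∀ {v} → v ∈ₛ BY j → Walk E (_∈ₛ BY j) v root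
    reach v∈ = Sum.[ from-spanner ∘ inj₁ , Sum.[ from-spanner ∘ inj₂ , from-link ]′ ∘ ∈-++⁻ Z ]′ (∈-∪ˡ⁻ (Y′ j) (ZY j) v∈)

  abstract
    Y-anchor : ∀ {j w} → w ∈ ZY j → ∃ λ y → y ∈ₛ Y′ j × M 𝒫 w y
    Y-anchor {j} {w} w∈ = Sum.[ from-spanner , from-link ]′ (∈-++⁻ (Spanner.Z (spanY j)) w∈)
      where
      from-spanner : w ∈ Spanner.Z (spanY j) → ∃ λ y → y ∈ₛ Y′ j × M 𝒫 w y
      from-spanner w∈Z =
        let P , P∈𝒫 , internal , A∈Y , _ = Spanner.bridged (spanY j) w∈Z
        in  endA P , A∈Y , P , P∈𝒫 , inj₁ refl , internal
      from-link : w ∈ ZE j → ∃ λ y → y ∈ₛ Y′ j × M 𝒫 w y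
      from-link w∈ZE =
        let x , _ , w∈W = ∈-concatMap⁻′ (λ x → Link.W x j) (allFin s) w∈ZE
            P , P∈𝒫 , internal , joins = Link.W-interior x j w∈W
        in  Link.b x j , Link.b∈Y x j , P , P∈𝒫 , start-is-end P joins , internal

  Branch : Fin s₁ ⊎ Fin t₁ → Fin n → Set
  Branch (inj₁ i) v = v ∈ₛ X′ i
  Branch (inj₂ j) v = v ∈ₛ Y′ j

  Branch-disjoint : ∀ {α β} → α ≢ β → ∀ {v} → Branch α v → Branch β v → ⊥
  Branch-disjoint {inj₁ i} {inj₁ i′} α≢β = disjXX i i′ (α≢β ∘ cong inj₁)
  Branch-disjoint {inj₁ i} {inj₂ j}  _   = disjXY i j
  Branch-disjoint {inj₂ j} {inj₁ i}  _   = flip (disjXY i j)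
  Branch-disjoint {inj₂ j} {inj₂ j′} α≢β = disjYY j j′ (α≢β ∘ cong inj₂)

  Z⊎ : Fin s₁ ⊎ Fin t₁ → List (Fin n)
  Z⊎ (inj₁ i) = ZX i
  Z⊎ (inj₂ j) = ZY j

  weight : Fin s₁ ⊎ Fin t₁ → ℕ
  weight (inj₁ _) = 2
  weight (inj₂ _) = 1

  witnesses : ∀ {w} α → w ∈ Z⊎ α → Witnesses Branch {M 𝒫 w} (weight α) α
  witnesses (inj₁ i) w∈ = both-ends w∈
  witnesses (inj₂ j) w∈ with y , y∈Y , w→y ← Y-anchor w∈ = y ∷ [] , [] ∷ [] , ≤-refl , λ { (here refl) → y∈Y , w→y }

  spread : ∀ w {J} → Unique J → (∀ {α} → α ∈ J → w ∈ Z⊎ α) → sum (map weight J) ≤ d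
  spread w J! J⊆ = witnesses-bound Branch Branch-disjoint weight (M-sparse w) J! (All.tabulate (λ α∈ → witnesses _ (J⊆ α∈)))

  Y-carriers : Fin n → List (Fin t₁)
  Y-carriers w = filter (λ j → w ∈ˡ? ZY j) (allFin _)

  Y-carriers! : ∀ w → Unique (Y-carriers w)
  Y-carriers! w = filter⁺ (λ j → w ∈ˡ? ZY j) (allFin⁺ _)

  ∈-Y-carriers : ∀ {w j} → j ∈ Y-carriers w → w ∈ ZY j
  ∈-Y-carriers {w} j∈ = proj₂ (∈-filter⁻ (λ j → w ∈ˡ? ZY j) {xs = allFin _} j∈)

  ZY-spread : ∀ w {J} → Unique J → (∀ {j} → j ∈ J → w ∈ ZY j) → 1 * length J ≤ d
  ZY-spread w {J} J! J⊆ = begin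
    1 * length J                 ≡⟨ sym (sum-map-const 1 J) ⟩
    sum (map (λ _ → 1) J)        ≡⟨ cong sum (map-∘ J) ⟩
    sum (map weight (map inj₂ J)) ≤⟨ spread w (map⁺ inj₂-injective J!) (λ α∈ → on-inj₂ (∈-map⁻ inj₂ α∈)) ⟩
    d                            ∎
    where
    open ≤-Reasoning
    on-inj₂ : ∀ {α} → (∃ λ j → j ∈ J × α ≡ inj₂ j) → w ∈ Z⊎ α
    on-inj₂ (_ , j∈J , refl) = J⊆ j∈J

  ZX-Y-spread : ∀ {i w} → w ∈ ZX i → 2 + length (Y-carriers w) ≤ d
  ZX-Y-spread {i} {w} w∈ZX = begin
    2 + length (Y-carriers w)                          ≡⟨ cong (2 +_) (sym (trans (sum-map-const 1 (Y-carriers w)) (*-identityˡ _))) ⟩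
    2 + sum (map (λ _ → 1) (Y-carriers w))             ≡⟨ cong (λ m → 2 + sum m) (map-∘ (Y-carriers w)) ⟩
    sum (map weight (inj₁ i ∷ map inj₂ (Y-carriers w))) ≤⟨ spread w J! J⊆ ⟩
    d                                                  ∎
    where
    open ≤-Reasoning
    J! : Unique (inj₁ i ∷ map inj₂ (Y-carriers w))
    J! = All.tabulate (λ α∈ → not-inj₂ (∈-map⁻ inj₂ α∈)) ∷ map⁺ inj₂-injective (Y-carriers! w)
      where
      not-inj₂ : ∀ {α} → (∃ λ j → j ∈ Y-carriers w × α ≡ inj₂ j) → inj₁ i ≢ α
      not-inj₂ (_ , _ , refl) ()
    J⊆ : ∀ {α} → α ∈ inj₁ i ∷ map inj₂ (Y-carriers w) → w ∈ Z⊎ α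
    J⊆ (here refl) = w∈ZX
    J⊆ (there α∈) = on-inj₂ (∈-map⁻ inj₂ α∈)
      where
      on-inj₂ : ∀ {α} → (∃ λ j → j ∈ Y-carriers w × α ≡ inj₂ j) → w ∈ Z⊎ α
      on-inj₂ (_ , j∈ , refl) = ∈-Y-carriers j∈

  touching : Fin n → List (Fin t₁)
  touching v = filter (λ j → (v ∈? Y′ j) ⊎-dec (v ∈ˡ? ZY j)) (allFin _)

  touching-length : ∀ {i v} → v ∈ₛ BX i → length (touching v) ≤ d
  touching-length {i} {v} v∈BX =
    ≤-trans (length-filter-∪ (λ j → v ∈? Y′ j) (λ j → v ∈ˡ? ZY j) (allFin _)) (by-cases (∈-∪ˡ⁻ (X′ i) (ZX i) v∈BX))
    where
    owners : List (Fin t₁)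
    owners = filter (λ j → v ∈? Y′ j) (allFin _)
    ∈-owners : ∀ {j} → j ∈ owners → v ∈ₛ Y′ j
    ∈-owners j∈ = proj₂ (∈-filter⁻ (λ j → v ∈? Y′ j) {xs = allFin _} j∈)
    by-cases : v ∈ₛ X′ i ⊎ v ∈ ZX i → length owners + length (Y-carriers v) ≤ d
    by-cases (inj₁ v∈X)  = +-mono-≤ (Unique⇒length≤ {ys = []} (filter⁺ (λ j → v ∈? Y′ j) (allFin⁺ _))
                                                        (λ j∈ → ⊥-elim (disjXY i _ v∈X (∈-owners j∈))))
                                    (≤-trans (≤-reflexive (sym (*-identityˡ _))) (ZY-spread v (Y-carriers! v) ∈-Y-carriers))
    by-cases (inj₂ v∈ZX) = ≤-trans (+-monoˡ-≤ _ owners≤1) (≤-trans (n≤1+n _) (ZX-Y-spread v∈ZX))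
      where
      owners≤1 : length owners ≤ 1
      owners≤1 = all-equal⇒length≤1 (filter⁺ (λ j → v ∈? Y′ j) (allFin⁺ _))
        (λ j∈ j′∈ → DisjointSubfamily.owner-unique Y′ disjYY ZY (∈-owners j∈) (∈-owners j′∈))

  forbidden : List (Fin t₁)
  forbidden = concatMap (λ x → concatMap touching (elements (BX (gX x)))) (allFin s)

  forbidden-length : length forbidden ≤ s * d * (p + K * (p ∸ 1))
  forbidden-length = begin
    length forbidden
      ≤⟨ length-concatMap-≤′ _ (allFin s) (λ {x} _ →
           ≤-trans (length-concatMap-≤′ touching (elements (BX (gX x)))
                     (λ v∈ → touching-length (∈-elements⁻ (BX (gX x)) v∈)))
                   (*-monoʳ-≤ d (≤-trans (≤-reflexive (length-elements (BX (gX x)))) (BX-size (gX x))))) ⟩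
    d * (p + K * (p ∸ 1)) * length (allFin s) ≡⟨ cong (d * (p + K * (p ∸ 1)) *_) (length-tabulate (λ x → x)) ⟩
    d * (p + K * (p ∸ 1)) * s                 ≡⟨ rearrange d (p + K * (p ∸ 1)) s ⟩
    s * d * (p + K * (p ∸ 1))                 ∎
    where
    open ≤-Reasoning
    rearrange : ∀ d m s → d * m * s ≡ s * d * m
    rearrange = solve-∀

  selectY : DisjointSubfamily.Subfamily Y′ disjYY ZY t forbidden
  selectY = DisjointSubfamily.disjoint-subfamily Y′ disjYY ZY {1} {d} ZY-spread {D = 2 * d * K * (s + q ∸ 1)} small
                                                 t forbidden forbidden-length ≤-refl
    where
    small : ∀ j → 2 * (d * length (ZY j)) ≤ 1 * (2 * d * K * (s + q ∸ 1))
    small j = ≤-trans (*-monoʳ-≤ 2 (*-monoʳ-≤ d (ZY-size j))) (≤-reflexive (rearrange d K (s + q ∸ 1)))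
      where
      rearrange : ∀ d K m → 2 * (d * (K * m)) ≡ 1 * (2 * d * K * m)
      rearrange = solve-∀

  open DisjointSubfamily.Subfamily selectY public using () renaming (pick to gY; avoids to gY∉forbidden; disjoint to Y-disjoint)

  XY-disjoint : ∀ x y → Disjoint (BX (gX x)) (BY (gY y))
  XY-disjoint x y {v} v∈BX v∈BY = gY∉forbidden y
    (∈-concatMap⁺′ (λ x → concatMap touching (elements (BX (gX x)))) (∈-allFin x)
      (∈-concatMap⁺′ touching (∈-elements⁺ v∈BX)
        (∈-filter⁺ (λ j → (v ∈? Y′ j) ⊎-dec (v ∈ˡ? ZY j)) (∈-allFin (gY y)) (∈-∪ˡ⁻ (Y′ (gY y)) (ZY (gY y)) v∈BY))))

  crossing-edge : ∀ x y → ∃ λ u → ∃ λ w → u ∈ₛ BX (gX x) × w ∈ₛ BY (gY y) × E u w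
  crossing-edge x y =
    let u , w , u∈BX , w∉BX , (_ , w∈ , e) = walk-exits (_∈? BX (gX x)) reach-end a∈BX b∉BX
    in  u , w , u∈BX , on-detour w∈ w∉BX , e
    where
    open Link x (gY y)
    a∈BX : a ∈ₛ BX (gX x)
    a∈BX = ∈-∪ˡ⁺ (X′ (gX x)) (ZX (gX x)) (inj₁ a∈X)
    b∈BY : b ∈ₛ BY (gY y)
    b∈BY = ∈-∪ˡ⁺ (Y′ (gY y)) (ZY (gY y)) (inj₁ b∈Y)
    b∉BX : b ∉ₛ BX (gX x)
    b∉BX b∈BX = XY-disjoint x y b∈BX b∈BY
    on-detour : ∀ {w} → w ≡ b ⊎ w ∈ W ⊎ w ≡ a → w ∉ₛ BX (gX x) → w ∈ₛ BY (gY y)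
    on-detour (inj₁ refl)        _    = b∈BY
    on-detour (inj₂ (inj₁ w∈W))  _    = ∈-∪ˡ⁺ (Y′ (gY y)) (ZY (gY y))
      (inj₂ (∈-++⁺ʳ (Spanner.Z (spanY (gY y))) (∈-concatMap⁺′ (λ x → Link.W x (gY y)) (∈-allFin x) w∈W)))
    on-detour (inj₂ (inj₂ refl)) a∉BX = ⊥-elim (a∉BX a∈BX)

lemma9 : (s t d k p q : ℕ) {n : ℕ} (G : Graph n) (𝒫 : ShortcutSystem G) →
    IsKDStar G k d 𝒫 →
    Model (AugE G 𝒫) (s′ s d k p) (t′ s t d k p q) p q →
    Model (Graph.E G) s t (p + (k ∸ 1) * (p ∸ 1)) (q + (k ∸ 1) * (s + q ∸ 1))
lemma9 s t d k p q G 𝒫 kd model = record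
  { X      = BX ∘ gX
  ; Y      = BY ∘ gY
  ; connX  = BX-connected ∘ gX
  ; connY  = BY-connected ∘ gY
  ; sizeX  = BX-size ∘ gX
  ; sizeY  = BY-size ∘ gY
  ; disjXX = λ _ _ → X-disjoint
  ; disjYY = λ _ _ → Y-disjoint
  ; disjXY = XY-disjoint
  ; edge   = crossing-edge
  }
  where open Construction s t d k p q G 𝒫 kd model
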